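{- For all integers $n\geq m\geq 2$, $$Q_{m-1}(x,y,z,t)Q_{n+1}(x,y,z,t)-Q_m(x,y,z,t)Q_n(x,y,z,t)\in\mathbb N[x,y,z,t],$$ i.e. the sequence $\{Q_n(x,y,z,t)\}_{n\geq 1}$ is strongly $\{x,y,z,t\}$-log-convex.
   Context: The generalized Ramanujan polynomials $Q_n(x,y,z,t)$ are defined by $Q_1=1$ and, for $n\geq1$, $Q_{n+1}=(x+nz)Q_n+(y+t)\left(nQ_n+y\,\frac{\partial Q_n}{\partial y}\right)$. For instance $Q_2=x+y+z+t$. -}

module Defs where

open import Data.Nat as ℕ using (ℕ; zero; suc; _∸_)
open import Data.Integer using (ℤ; +_; _+_; _*_; _-_; _≤_)

-- Formal power series (in particular polynomials) in the four commuting
-- variables x, y, z, t with integer coefficients: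
-- p i j k l  is the coefficient of  x^i y^j z^k t^l.
Poly : Set
Poly = ℕ → ℕ → ℕ → ℕ → ℤ

sumTo : ℕ → (ℕ → ℤ) → ℤ
sumTo zero    f = f zero
sumTo (suc n) f = sumTo n f + f (suc n)

0P : Poly
0P _ _ _ _ = + 0

1P : Poly
1P zero zero zero zero = + 1
1P _    _    _    _    = + 0

_+P_ : Poly → Poly → Poly
(p +P q) i j k l = p i j k l + q i j k l

_-P_ : Poly → Poly → Poly
(p -P q) i j k l = p i j k l - q i j k l

_·P_ : ℕ → Poly → Poly
(c ·P p) i j k l = + c * p i j k l

_*P_ : Poly → Poly → Poly
(p *P q) i j k l =
  sumTo i λ a → sumTo j λ b → sumTo k λ c → sumTo l λ d →
    p a b c d * q (i ∸ a) (j ∸ b) (k ∸ c) (l ∸ d)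

infixl 6 _+P_ _-P_
infixl 7 _*P_ _·P_

X Y Z T : Poly
X (suc zero) zero zero zero = + 1
X _ _ _ _ = + 0
Y zero (suc zero) zero zero = + 1
Y _ _ _ _ = + 0
Z zero zero (suc zero) zero = + 1
Z _ _ _ _ = + 0
T zero zero zero (suc zero) = + 1
T _ _ _ _ = + 0

yDy : Poly → Poly
yDy p i j k l = + j * p i j k l

-- Generalized Ramanujan polynomials: Q 1 = 1,
-- Q (n+1) = (x + n z) Q n + (y + t) (n Q n + y ∂Q n/∂y)   (n ≥ 1).
-- Q 0 is not used by the paper; we set it to 0 by convention.
Q : ℕ → Poly
Q zero = 0P
Q (suc zero) = 1P
Q (suc (suc n)) =
  (X +P (suc n) ·P Z) *P Q (suc n)
  +P (Y +P T) *P ((suc n) ·P Q (suc n) +P yDy (Q (suc n)))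

InNatPoly : Poly → Set
InNatPoly p = ∀ i j k l → + 0 ≤ p i j k l

module Submission where

-- Write D = y ∂/∂y and W(g, h) = g · D h - D g · h.  With L(c, u, v) = (x + c z) u + (y + t) (c u + v)
-- the recurrence reads Q (n + 1) = L(n, Q n, D Q n), and L is linear in (u, v) and commutes with
-- multiplication, so for c' ≤ c
--   g · L(c, h, D h) - L(c', g, D g) · h = (c - c') (z + y + t) g h + (y + t) W(g, h).
-- It therefore suffices that W(Q j, Q n) has nonnegative coefficients for j ≤ n.  This is proved in
-- the stronger form W(g, Dʳ h) ≥ 0 for all r, which is stable under h ↦ x h, z h, t h, D h, under
-- sums and, since D(y h) = y h + y D h, under h ↦ y h; hence under h ↦ L(c, h, D h).  It holds for
-- h = g because the coefficients of W(g, Dʳ g) pair up into terms g_a g_b (β - α)(βʳ - αʳ) ≥ 0,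
-- where α, β are the y-exponents of the indices a, b.

open import Defs
open import Data.Nat as ℕ using (ℕ; zero; suc; _≤_; _∸_; _^_; z≤n; s≤s; _≤′_; ≤′-refl; ≤′-step)
import Data.Nat.Properties as ℕₚ
open import Data.Integer as ℤ using (ℤ; +_; -[1+_]; _+_; _*_; _-_; +≤+)
import Data.Integer.Properties as ℤₚ
open import Data.Integer.Tactic.RingSolver using (solve-∀)
open import Data.Product using (_,_)
open import Data.Sum using (inj₁; inj₂)
open import Relation.Binary.Bundles using (Setoid)
import Relation.Binary.Reasoning.Setoid as SetoidReasoning
open import Relation.Binary.PropositionalEquality

+-nonneg : ∀ {a b} → + 0 ℤ.≤ a → + 0 ℤ.≤ b → + 0 ℤ.≤ a + b
+-nonneg = ℤₚ.+-mono-≤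

*-nonneg : ∀ {a b} → + 0 ℤ.≤ a → + 0 ℤ.≤ b → + 0 ℤ.≤ a * b
*-nonneg {+ m} {+ n} _ _ = subst (+ 0 ℤ.≤_) (ℤₚ.pos-* m n) (+≤+ z≤n)

n*-nonneg : ∀ n {a} → + 0 ℤ.≤ a → + 0 ℤ.≤ + n * a
n*-nonneg n = *-nonneg {+ n} (+≤+ z≤n)

nonneg-half : ∀ a → + 0 ℤ.≤ a + a → + 0 ℤ.≤ a
nonneg-half (+ n)    _  = +≤+ z≤n
nonneg-half -[1+ n ] ()

[x-y]*[u-v]≥0 : ∀ {x y u v} → x ≤ y → u ≤ v → + 0 ℤ.≤ (+ x - + y) * (+ u - + v)
[x-y]*[u-v]≥0 {x} {u = u} x≤y u≤v
  with ℕₚ.m≤n⇒∃[o]m+o≡n x≤y | ℕₚ.m≤n⇒∃[o]m+o≡n u≤v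
... | e , refl | f , refl rewrite ℤₚ.pos-+ x e | ℤₚ.pos-+ u f =
  subst (+ 0 ℤ.≤_) (trans (ℤₚ.pos-* e f) (sym (ordered (+ x) (+ e) (+ u) (+ f)))) (+≤+ z≤n)
  where
  ordered : ∀ a b c d → (a - (a + b)) * (c - (c + d)) ≡ b * d
  ordered = solve-∀

[x-y]*[x^r-y^r]≥0 : ∀ x y r → + 0 ℤ.≤ (+ x - + y) * (+ (x ^ r) - + (y ^ r))
[x-y]*[x^r-y^r]≥0 x y r with ℕₚ.≤-total x y
... | inj₁ x≤y = [x-y]*[u-v]≥0 x≤y (ℕₚ.^-monoˡ-≤ r x≤y)
... | inj₂ y≤x =
  subst (+ 0 ℤ.≤_) (swap (+ y) (+ x) (+ (y ^ r)) (+ (x ^ r))) ([x-y]*[u-v]≥0 y≤x (ℕₚ.^-monoˡ-≤ r y≤x))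
  where
  swap : ∀ a b c d → (a - b) * (c - d) ≡ (b - a) * (d - c)
  swap = solve-∀

sumTo-cong : ∀ n {f g : ℕ → ℤ} → (∀ a → a ≤ n → f a ≡ g a) → sumTo n f ≡ sumTo n g
sumTo-cong zero    f≗g = f≗g zero z≤n
sumTo-cong (suc n) f≗g =
  cong₂ _+_ (sumTo-cong n λ a a≤n → f≗g a (ℕₚ.m≤n⇒m≤1+n a≤n)) (f≗g (suc n) ℕₚ.≤-refl)

sumTo-+ : ∀ n (f g : ℕ → ℤ) → sumTo n (λ a → f a + g a) ≡ sumTo n f + sumTo n g
sumTo-+ zero    f g = refl
sumTo-+ (suc n) f g rewrite sumTo-+ n f g = interchange (sumTo n f) (sumTo n g) (f (suc n)) (g (suc n))
  where
  interchange : ∀ a b c d → a + b + (c + d) ≡ a + c + (b + d)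
  interchange = solve-∀

sumTo-sub : ∀ n (f g : ℕ → ℤ) → sumTo n (λ a → f a - g a) ≡ sumTo n f - sumTo n g
sumTo-sub zero    f g = refl
sumTo-sub (suc n) f g rewrite sumTo-sub n f g =
  interchange (sumTo n f) (sumTo n g) (f (suc n)) (g (suc n))
  where
  interchange : ∀ a b c d → a - b + (c - d) ≡ a + c - (b + d)
  interchange = solve-∀

sumTo-*ˡ : ∀ n c (f : ℕ → ℤ) → sumTo n (λ a → c * f a) ≡ c * sumTo n f
sumTo-*ˡ zero    c f = refl
sumTo-*ˡ (suc n) c f rewrite sumTo-*ˡ n c f = sym (ℤₚ.*-distribˡ-+ c (sumTo n f) (f (suc n)))

sumTo-zero : ∀ n (f : ℕ → ℤ) → (∀ a → f a ≡ + 0) → sumTo n f ≡ + 0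
sumTo-zero zero    f f≡0 = f≡0 zero
sumTo-zero (suc n) f f≡0 rewrite sumTo-zero n f f≡0 | f≡0 (suc n) = refl

sumTo-nonneg : ∀ n (f : ℕ → ℤ) → (∀ a → a ≤ n → + 0 ℤ.≤ f a) → + 0 ℤ.≤ sumTo n f
sumTo-nonneg zero    f f≥0 = f≥0 zero z≤n
sumTo-nonneg (suc n) f f≥0 =
  +-nonneg (sumTo-nonneg n f λ a a≤n → f≥0 a (ℕₚ.m≤n⇒m≤1+n a≤n)) (f≥0 (suc n) ℕₚ.≤-refl)

sumTo-unfoldˡ : ∀ n (f : ℕ → ℤ) → sumTo (suc n) f ≡ f 0 + sumTo n (λ a → f (suc a))
sumTo-unfoldˡ zero    f = refl
sumTo-unfoldˡ (suc n) f rewrite sumTo-unfoldˡ n f = ℤₚ.+-assoc (f 0) _ _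

sumTo-first : ∀ n (f : ℕ → ℤ) → (∀ a → f (suc a) ≡ + 0) → sumTo n f ≡ f 0
sumTo-first zero    f _    = refl
sumTo-first (suc n) f f≡0 =
  trans (sumTo-unfoldˡ n f) (trans (cong (_+_ (f 0)) (sumTo-zero n _ f≡0)) (ℤₚ.+-identityʳ (f 0)))

sumTo-reverse : ∀ n (f : ℕ → ℤ) → sumTo n f ≡ sumTo n (λ a → f (n ∸ a))
sumTo-reverse zero    f = refl
sumTo-reverse (suc n) f =
  trans (cong (_+ f (suc n)) (sumTo-reverse n f))
        (trans (ℤₚ.+-comm _ (f (suc n))) (sym (sumTo-unfoldˡ n λ a → f (suc n ∸ a))))

sumTo-convolution-suc : ∀ n (H : ℕ → ℕ → ℤ) → (∀ a → H a 0 ≡ + 0) →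
  sumTo (suc n) (λ a → H a (suc n ∸ a)) ≡ sumTo n (λ a → H a (suc (n ∸ a)))
sumTo-convolution-suc n H H≡0 rewrite ℕₚ.n∸n≡0 n | H≡0 (suc n) =
  trans (ℤₚ.+-identityʳ _) (sumTo-cong n λ a a≤n → cong (H a) (ℕₚ.+-∸-assoc 1 a≤n))

Σ⁴ : ℕ → ℕ → ℕ → ℕ → (ℕ → ℕ → ℕ → ℕ → ℤ) → ℤ
Σ⁴ i j k l F = sumTo i λ a → sumTo j λ b → sumTo k λ c → sumTo l λ d → F a b c d

Σ⁴-cong-≤ : ∀ i j k l {F G} →
  (∀ a b c d → a ≤ i → b ≤ j → c ≤ k → d ≤ l → F a b c d ≡ G a b c d) → Σ⁴ i j k l F ≡ Σ⁴ i j k l G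
Σ⁴-cong-≤ i j k l F≗G =
  sumTo-cong i λ a a≤i → sumTo-cong j λ b b≤j → sumTo-cong k λ c c≤k → sumTo-cong l λ d d≤l →
  F≗G a b c d a≤i b≤j c≤k d≤l

Σ⁴-cong : ∀ i j k l {F G} → (∀ a b c d → F a b c d ≡ G a b c d) → Σ⁴ i j k l F ≡ Σ⁴ i j k l G
Σ⁴-cong i j k l F≗G = Σ⁴-cong-≤ i j k l λ a b c d _ _ _ _ → F≗G a b c d

Σ⁴-homomorphic : (_∙_ : ℤ → ℤ → ℤ) →
  (∀ n f g → sumTo n (λ a → f a ∙ g a) ≡ sumTo n f ∙ sumTo n g) →
  ∀ i j k l F G → Σ⁴ i j k l (λ a b c d → F a b c d ∙ G a b c d) ≡ Σ⁴ i j k l F ∙ Σ⁴ i j k l G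
Σ⁴-homomorphic _∙_ hom i j k l F G =
  trans (sumTo-cong i λ a _ →
         trans (sumTo-cong j λ b _ → trans (sumTo-cong k λ c _ → hom l _ _) (hom k _ _)) (hom j _ _))
        (hom i _ _)

Σ⁴-+ : ∀ i j k l F G → Σ⁴ i j k l (λ a b c d → F a b c d + G a b c d) ≡ Σ⁴ i j k l F + Σ⁴ i j k l G
Σ⁴-+ = Σ⁴-homomorphic _+_ sumTo-+

Σ⁴-sub : ∀ i j k l F G → Σ⁴ i j k l (λ a b c d → F a b c d - G a b c d) ≡ Σ⁴ i j k l F - Σ⁴ i j k l G
Σ⁴-sub = Σ⁴-homomorphic _-_ sumTo-sub

Σ⁴-*ˡ : ∀ i j k l x F → Σ⁴ i j k l (λ a b c d → x * F a b c d) ≡ x * Σ⁴ i j k l F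
Σ⁴-*ˡ i j k l x F =
  trans (sumTo-cong i λ a _ →
         trans (sumTo-cong j λ b _ → trans (sumTo-cong k λ c _ → sumTo-*ˡ l x _) (sumTo-*ˡ k x _))
               (sumTo-*ˡ j x _))
        (sumTo-*ˡ i x _)

Σ⁴-zero : ∀ i j k l F → (∀ a b c d → F a b c d ≡ + 0) → Σ⁴ i j k l F ≡ + 0
Σ⁴-zero i j k l F F≡0 =
  sumTo-zero i _ λ a → sumTo-zero j _ λ b → sumTo-zero k _ λ c → sumTo-zero l _ λ d → F≡0 a b c d

Σ⁴-nonneg : ∀ i j k l F →
  (∀ a b c d → a ≤ i → b ≤ j → c ≤ k → d ≤ l → + 0 ℤ.≤ F a b c d) → + 0 ℤ.≤ Σ⁴ i j k l F
Σ⁴-nonneg i j k l F F≥0 =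
  sumTo-nonneg i _ λ a a≤i → sumTo-nonneg j _ λ b b≤j → sumTo-nonneg k _ λ c c≤k →
  sumTo-nonneg l _ λ d d≤l → F≥0 a b c d a≤i b≤j c≤k d≤l

Σ⁴-reverse : ∀ i j k l F →
  Σ⁴ i j k l F ≡ Σ⁴ i j k l (λ a b c d → F (i ∸ a) (j ∸ b) (k ∸ c) (l ∸ d))
Σ⁴-reverse i j k l F =
  trans (sumTo-reverse i _) (sumTo-cong i λ a _ →
  trans (sumTo-reverse j _) (sumTo-cong j λ b _ →
  trans (sumTo-reverse k _) (sumTo-cong k λ c _ → sumTo-reverse l _)))

Σ⁴-nonneg-by-pairing : ∀ i j k l F →
  (∀ a b c d → a ≤ i → b ≤ j → c ≤ k → d ≤ l →
     + 0 ℤ.≤ F a b c d + F (i ∸ a) (j ∸ b) (k ∸ c) (l ∸ d)) →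
  + 0 ℤ.≤ Σ⁴ i j k l F
Σ⁴-nonneg-by-pairing i j k l F pair≥0 =
  nonneg-half (Σ⁴ i j k l F) (subst (+ 0 ℤ.≤_) (sym twice) (Σ⁴-nonneg i j k l _ pair≥0))
  where
  twice : Σ⁴ i j k l F + Σ⁴ i j k l F ≡
          Σ⁴ i j k l (λ a b c d → F a b c d + F (i ∸ a) (j ∸ b) (k ∸ c) (l ∸ d))
  twice = trans (cong (_+_ (Σ⁴ i j k l F)) (Σ⁴-reverse i j k l F))
                (sym (Σ⁴-+ i j k l F λ a b c d → F (i ∸ a) (j ∸ b) (k ∸ c) (l ∸ d)))

infix 4 _≈_
_≈_ : Poly → Poly → Set
p ≈ q = ∀ i j k l → p i j k l ≡ q i j k l

≈-refl : ∀ {p} → p ≈ p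
≈-refl _ _ _ _ = refl

≈-sym : ∀ {p q} → p ≈ q → q ≈ p
≈-sym p≈q i j k l = sym (p≈q i j k l)

≈-trans : ∀ {p q r} → p ≈ q → q ≈ r → p ≈ r
≈-trans p≈q q≈r i j k l = trans (p≈q i j k l) (q≈r i j k l)

≈-setoid : Setoid _ _
≈-setoid = record
  { Carrier = Poly ; _≈_ = _≈_
  ; isEquivalence = record { refl = ≈-refl ; sym = ≈-sym ; trans = ≈-trans } }

module ≈-Reasoning = SetoidReasoning ≈-setoid

+P-cong : ∀ {p p' q q'} → p ≈ p' → q ≈ q' → p +P q ≈ p' +P q'
+P-cong p≈p' q≈q' i j k l = cong₂ _+_ (p≈p' i j k l) (q≈q' i j k l)

-P-cong : ∀ {p p' q q'} → p ≈ p' → q ≈ q' → p -P q ≈ p' -P q'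
-P-cong p≈p' q≈q' i j k l = cong₂ _-_ (p≈p' i j k l) (q≈q' i j k l)

·P-cong : ∀ n {p p'} → p ≈ p' → n ·P p ≈ n ·P p'
·P-cong n p≈p' i j k l = cong (+ n *_) (p≈p' i j k l)

*P-congˡ : ∀ {p p'} q → p ≈ p' → p *P q ≈ p' *P q
*P-congˡ q p≈p' i j k l = Σ⁴-cong i j k l λ a b c d → cong (_* _) (p≈p' a b c d)

*P-congʳ : ∀ p {q q'} → q ≈ q' → p *P q ≈ p *P q'
*P-congʳ p q≈q' i j k l =
  Σ⁴-cong i j k l λ a b c d → cong (p a b c d *_) (q≈q' (i ∸ a) (j ∸ b) (k ∸ c) (l ∸ d))

*P-comm : ∀ p q → p *P q ≈ q *P p
*P-comm p q i j k l = trans (Σ⁴-reverse i j k l _) (Σ⁴-cong-≤ i j k l swap)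
  where
  swap : ∀ a b c d → a ≤ i → b ≤ j → c ≤ k → d ≤ l →
    p (i ∸ a) (j ∸ b) (k ∸ c) (l ∸ d) * q (i ∸ (i ∸ a)) (j ∸ (j ∸ b)) (k ∸ (k ∸ c)) (l ∸ (l ∸ d))
    ≡ q a b c d * p (i ∸ a) (j ∸ b) (k ∸ c) (l ∸ d)
  swap a b c d a≤i b≤j c≤k d≤l
    rewrite ℕₚ.m∸[m∸n]≡n a≤i | ℕₚ.m∸[m∸n]≡n b≤j | ℕₚ.m∸[m∸n]≡n c≤k | ℕₚ.m∸[m∸n]≡n d≤l =
    ℤₚ.*-comm (p (i ∸ a) (j ∸ b) (k ∸ c) (l ∸ d)) (q a b c d)

*P-distribˡ-+P : ∀ p q r → p *P (q +P r) ≈ p *P q +P p *P r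
*P-distribˡ-+P p q r i j k l =
  trans (Σ⁴-cong i j k l λ a b c d → ℤₚ.*-distribˡ-+ (p a b c d) _ _) (Σ⁴-+ i j k l _ _)

*P-distribʳ-+P : ∀ p q r → (q +P r) *P p ≈ q *P p +P r *P p
*P-distribʳ-+P p q r =
  ≈-trans (*P-comm (q +P r) p) (≈-trans (*P-distribˡ-+P p q r) (+P-cong (*P-comm p q) (*P-comm p r)))

*P-·Pʳ : ∀ n p q → p *P (n ·P q) ≈ n ·P (p *P q)
*P-·Pʳ n p q i j k l =
  trans (Σ⁴-cong i j k l λ a b c d → exchange (p a b c d) (+ n) _) (Σ⁴-*ˡ i j k l (+ n) _)
  where
  exchange : ∀ a b c → a * (b * c) ≡ b * (a * c)
  exchange = solve-∀

*P-·Pˡ : ∀ n p q → (n ·P p) *P q ≈ n ·P (p *P q)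
*P-·Pˡ n p q i j k l =
  trans (Σ⁴-cong i j k l λ a b c d → ℤₚ.*-assoc (+ n) (p a b c d) _) (Σ⁴-*ˡ i j k l (+ n) _)

*P-identityˡ : ∀ q → 1P *P q ≈ q
*P-identityˡ q i j k l =
  trans (sumTo-first i _ λ a → sumTo-zero j _ λ b → sumTo-zero k _ λ c → sumTo-zero l _ λ d → refl)
  (trans (sumTo-first j _ λ b → sumTo-zero k _ λ c → sumTo-zero l _ λ d → refl)
  (trans (sumTo-first k _ λ c → sumTo-zero l _ λ d → refl)
  (trans (sumTo-first l _ λ d → refl) (ℤₚ.*-identityˡ _))))

*P-identityʳ : ∀ q → q *P 1P ≈ q
*P-identityʳ q = ≈-trans (*P-comm q 1P) (*P-identityˡ q)

≈-nonneg : ∀ {p q} → p ≈ q → InNatPoly q → InNatPoly p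
≈-nonneg p≈q q≥0 i j k l rewrite p≈q i j k l = q≥0 i j k l

1P-nonneg : InNatPoly 1P
1P-nonneg zero    zero    zero    zero    = +≤+ z≤n
1P-nonneg zero    zero    zero    (suc l) = +≤+ z≤n
1P-nonneg zero    zero    (suc k) l       = +≤+ z≤n
1P-nonneg zero    (suc j) k       l       = +≤+ z≤n
1P-nonneg (suc i) j       k       l       = +≤+ z≤n

+P-nonneg : ∀ {p q} → InNatPoly p → InNatPoly q → InNatPoly (p +P q)
+P-nonneg p≥0 q≥0 i j k l = +-nonneg (p≥0 i j k l) (q≥0 i j k l)

·P-nonneg : ∀ n {p} → InNatPoly p → InNatPoly (n ·P p)
·P-nonneg n p≥0 i j k l = n*-nonneg n (p≥0 i j k l)

*P-nonneg : ∀ {p q} → InNatPoly p → InNatPoly q → InNatPoly (p *P q)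
*P-nonneg p≥0 q≥0 i j k l = Σ⁴-nonneg i j k l _ λ a b c d _ _ _ _ → *-nonneg (p≥0 _ _ _ _) (q≥0 _ _ _ _)

mulX mulY mulZ mulT : Poly → Poly
mulX p zero    j k l = + 0
mulX p (suc i) j k l = p i j k l
mulY p i zero    k l = + 0
mulY p i (suc j) k l = p i j k l
mulZ p i j zero    l = + 0
mulZ p i j (suc k) l = p i j k l
mulT p i j k zero    = + 0
mulT p i j k (suc l) = p i j k l

mulX-cong : ∀ {p q} → p ≈ q → mulX p ≈ mulX q
mulX-cong p≈q zero    j k l = refl
mulX-cong p≈q (suc i) j k l = p≈q i j k l
mulY-cong : ∀ {p q} → p ≈ q → mulY p ≈ mulY q
mulY-cong p≈q i zero    k l = refl
mulY-cong p≈q i (suc j) k l = p≈q i j k l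
mulZ-cong : ∀ {p q} → p ≈ q → mulZ p ≈ mulZ q
mulZ-cong p≈q i j zero    l = refl
mulZ-cong p≈q i j (suc k) l = p≈q i j k l
mulT-cong : ∀ {p q} → p ≈ q → mulT p ≈ mulT q
mulT-cong p≈q i j k zero    = refl
mulT-cong p≈q i j k (suc l) = p≈q i j k l

mulX-sub : ∀ p q → mulX p -P mulX q ≈ mulX (p -P q)
mulX-sub p q zero    j k l = refl
mulX-sub p q (suc i) j k l = refl
mulY-sub : ∀ p q → mulY p -P mulY q ≈ mulY (p -P q)
mulY-sub p q i zero    k l = refl
mulY-sub p q i (suc j) k l = refl
mulZ-sub : ∀ p q → mulZ p -P mulZ q ≈ mulZ (p -P q)
mulZ-sub p q i j zero    l = refl
mulZ-sub p q i j (suc k) l = refl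
mulT-sub : ∀ p q → mulT p -P mulT q ≈ mulT (p -P q)
mulT-sub p q i j k zero    = refl
mulT-sub p q i j k (suc l) = refl

mulX-nonneg : ∀ {p} → InNatPoly p → InNatPoly (mulX p)
mulX-nonneg p≥0 zero    j k l = +≤+ z≤n
mulX-nonneg p≥0 (suc i) j k l = p≥0 i j k l
mulY-nonneg : ∀ {p} → InNatPoly p → InNatPoly (mulY p)
mulY-nonneg p≥0 i zero    k l = +≤+ z≤n
mulY-nonneg p≥0 i (suc j) k l = p≥0 i j k l
mulZ-nonneg : ∀ {p} → InNatPoly p → InNatPoly (mulZ p)
mulZ-nonneg p≥0 i j zero    l = +≤+ z≤n
mulZ-nonneg p≥0 i j (suc k) l = p≥0 i j k l
mulT-nonneg : ∀ {p} → InNatPoly p → InNatPoly (mulT p)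
mulT-nonneg p≥0 i j k zero    = +≤+ z≤n
mulT-nonneg p≥0 i j k (suc l) = p≥0 i j k l

*P-mulX : ∀ p q → p *P mulX q ≈ mulX (p *P q)
*P-mulX p q zero    j k l = Σ⁴-zero 0 j k l _ λ a b c d → ℤₚ.*-zeroʳ (p a b c d)
*P-mulX p q (suc i) j k l =
  sumTo-convolution-suc i (λ a m → sumTo j λ b → sumTo k λ c → sumTo l λ d →
                                    p a b c d * mulX q m (j ∸ b) (k ∸ c) (l ∸ d))
    λ a → sumTo-zero j _ λ b → sumTo-zero k _ λ c → sumTo-zero l _ λ d → ℤₚ.*-zeroʳ (p a b c d)

*P-mulY : ∀ p q → p *P mulY q ≈ mulY (p *P q)
*P-mulY p q i zero    k l = Σ⁴-zero i 0 k l _ λ a b c d → ℤₚ.*-zeroʳ (p a b c d)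
*P-mulY p q i (suc j) k l = sumTo-cong i λ a _ →
  sumTo-convolution-suc j
    (λ b m → sumTo k λ c → sumTo l λ d → p a b c d * mulY q (i ∸ a) m (k ∸ c) (l ∸ d))
    λ b → sumTo-zero k _ λ c → sumTo-zero l _ λ d → ℤₚ.*-zeroʳ (p a b c d)

*P-mulZ : ∀ p q → p *P mulZ q ≈ mulZ (p *P q)
*P-mulZ p q i j zero    l = Σ⁴-zero i j 0 l _ λ a b c d → ℤₚ.*-zeroʳ (p a b c d)
*P-mulZ p q i j (suc k) l = sumTo-cong i λ a _ → sumTo-cong j λ b _ →
  sumTo-convolution-suc k (λ c m → sumTo l λ d → p a b c d * mulZ q (i ∸ a) (j ∸ b) m (l ∸ d))
    λ c → sumTo-zero l _ λ d → ℤₚ.*-zeroʳ (p a b c d)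

*P-mulT : ∀ p q → p *P mulT q ≈ mulT (p *P q)
*P-mulT p q i j k zero    = Σ⁴-zero i j k 0 _ λ a b c d → ℤₚ.*-zeroʳ (p a b c d)
*P-mulT p q i j k (suc l) = sumTo-cong i λ a _ → sumTo-cong j λ b _ → sumTo-cong k λ c _ →
  sumTo-convolution-suc l (λ d m → p a b c d * mulT q (i ∸ a) (j ∸ b) (k ∸ c) m)
    λ d → ℤₚ.*-zeroʳ (p a b c d)

X≈mulX1P : X ≈ mulX 1P
X≈mulX1P zero          j       k       l       = refl
X≈mulX1P (suc zero)    zero    zero    zero    = refl
X≈mulX1P (suc zero)    zero    zero    (suc l) = refl
X≈mulX1P (suc zero)    zero    (suc k) l       = refl
X≈mulX1P (suc zero)    (suc j) k       l       = refl
X≈mulX1P (suc (suc i)) j       k       l       = refl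

Y≈mulY1P : Y ≈ mulY 1P
Y≈mulY1P zero    zero          k       l       = refl
Y≈mulY1P zero    (suc zero)    zero    zero    = refl
Y≈mulY1P zero    (suc zero)    zero    (suc l) = refl
Y≈mulY1P zero    (suc zero)    (suc k) l       = refl
Y≈mulY1P zero    (suc (suc j)) k       l       = refl
Y≈mulY1P (suc i) zero          k       l       = refl
Y≈mulY1P (suc i) (suc j)       k       l       = refl

Z≈mulZ1P : Z ≈ mulZ 1P
Z≈mulZ1P zero    zero    zero          l       = refl
Z≈mulZ1P zero    zero    (suc zero)    zero    = refl
Z≈mulZ1P zero    zero    (suc zero)    (suc l) = refl
Z≈mulZ1P zero    zero    (suc (suc k)) l       = refl
Z≈mulZ1P zero    (suc j) zero          l       = refl
Z≈mulZ1P zero    (suc j) (suc k)       l       = refl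
Z≈mulZ1P (suc i) j       zero          l       = refl
Z≈mulZ1P (suc i) j       (suc k)       l       = refl

T≈mulT1P : T ≈ mulT 1P
T≈mulT1P zero    zero    zero    zero          = refl
T≈mulT1P zero    zero    zero    (suc zero)    = refl
T≈mulT1P zero    zero    zero    (suc (suc l)) = refl
T≈mulT1P zero    zero    (suc k) zero          = refl
T≈mulT1P zero    zero    (suc k) (suc l)       = refl
T≈mulT1P zero    (suc j) k       zero          = refl
T≈mulT1P zero    (suc j) k       (suc l)       = refl
T≈mulT1P (suc i) j       k       zero          = refl
T≈mulT1P (suc i) j       k       (suc l)       = refl

variable-*P : ∀ {V} (mulV : Poly → Poly) → (∀ {p q} → p ≈ q → mulV p ≈ mulV q) →
  (∀ p q → p *P mulV q ≈ mulV (p *P q)) → V ≈ mulV 1P → ∀ p → V *P p ≈ mulV p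
variable-*P {V} mulV mulV-cong *P-mulV V≈mulV1P p = begin
  V *P p          ≈⟨ *P-comm V p ⟩
  p *P V          ≈⟨ *P-congʳ p V≈mulV1P ⟩
  p *P mulV 1P    ≈⟨ *P-mulV p 1P ⟩
  mulV (p *P 1P)  ≈⟨ mulV-cong (*P-identityʳ p) ⟩
  mulV p          ∎
  where open ≈-Reasoning

X*P≈mulX : ∀ p → X *P p ≈ mulX p
X*P≈mulX = variable-*P mulX mulX-cong *P-mulX X≈mulX1P
Y*P≈mulY : ∀ p → Y *P p ≈ mulY p
Y*P≈mulY = variable-*P mulY mulY-cong *P-mulY Y≈mulY1P
Z*P≈mulZ : ∀ p → Z *P p ≈ mulZ p
Z*P≈mulZ = variable-*P mulZ mulZ-cong *P-mulZ Z≈mulZ1P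
T*P≈mulT : ∀ p → T *P p ≈ mulT p
T*P≈mulT = variable-*P mulT mulT-cong *P-mulT T≈mulT1P

yDy-cong : ∀ {p q} → p ≈ q → yDy p ≈ yDy q
yDy-cong p≈q i j k l = cong (+ j *_) (p≈q i j k l)

yDy-+P : ∀ p q → yDy (p +P q) ≈ yDy p +P yDy q
yDy-+P p q i j k l = ℤₚ.*-distribˡ-+ (+ j) (p i j k l) (q i j k l)

yDy-·P : ∀ n p → yDy (n ·P p) ≈ n ·P yDy p
yDy-·P n p i j k l = exchange (+ j) (+ n) (p i j k l)
  where
  exchange : ∀ a b c → a * (b * c) ≡ b * (a * c)
  exchange = solve-∀

yDy-nonneg : ∀ {p} → InNatPoly p → InNatPoly (yDy p)
yDy-nonneg p≥0 i j k l = n*-nonneg j (p≥0 i j k l)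

yDy-mulX : ∀ p → yDy (mulX p) ≈ mulX (yDy p)
yDy-mulX p zero    j k l = ℤₚ.*-zeroʳ (+ j)
yDy-mulX p (suc i) j k l = refl
yDy-mulZ : ∀ p → yDy (mulZ p) ≈ mulZ (yDy p)
yDy-mulZ p i j zero    l = ℤₚ.*-zeroʳ (+ j)
yDy-mulZ p i j (suc k) l = refl
yDy-mulT : ∀ p → yDy (mulT p) ≈ mulT (yDy p)
yDy-mulT p i j k zero    = ℤₚ.*-zeroʳ (+ j)
yDy-mulT p i j k (suc l) = refl

yDy-mulY : ∀ p → yDy (mulY p) ≈ mulY p +P mulY (yDy p)
yDy-mulY p i zero    k l = refl
yDy-mulY p i (suc j) k l = trans (cong (_* p i j k l) (ℤₚ.pos-+ 1 j)) (expand (+ j) (p i j k l))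
  where
  expand : ∀ a b → (+ 1 + a) * b ≡ b + a * b
  expand = solve-∀

yDyⁿ : ℕ → Poly → Poly
yDyⁿ zero    h = h
yDyⁿ (suc r) h = yDyⁿ r (yDy h)

yDyⁿ-cong : ∀ r {p q} → p ≈ q → yDyⁿ r p ≈ yDyⁿ r q
yDyⁿ-cong zero    p≈q = p≈q
yDyⁿ-cong (suc r) p≈q = yDyⁿ-cong r (yDy-cong p≈q)

yDyⁿ-+P : ∀ r p q → yDyⁿ r (p +P q) ≈ yDyⁿ r p +P yDyⁿ r q
yDyⁿ-+P zero    p q = ≈-refl
yDyⁿ-+P (suc r) p q = ≈-trans (yDyⁿ-cong r (yDy-+P p q)) (yDyⁿ-+P r (yDy p) (yDy q))

yDyⁿ-·P : ∀ r n p → yDyⁿ r (n ·P p) ≈ n ·P yDyⁿ r p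
yDyⁿ-·P zero    n p = ≈-refl
yDyⁿ-·P (suc r) n p = ≈-trans (yDyⁿ-cong r (yDy-·P n p)) (yDyⁿ-·P r n (yDy p))

yDyⁿ-coefficient : ∀ r h i j k l → yDyⁿ r h i j k l ≡ + (j ^ r) * h i j k l
yDyⁿ-coefficient zero    h i j k l = sym (ℤₚ.*-identityˡ (h i j k l))
yDyⁿ-coefficient (suc r) h i j k l =
  trans (yDyⁿ-coefficient r (yDy h) i j k l)
        (trans (regroup (+ (j ^ r)) (+ j) (h i j k l)) (cong (_* h i j k l) (sym (ℤₚ.pos-* j (j ^ r)))))
  where
  regroup : ∀ a b c → a * (b * c) ≡ b * a * c
  regroup = solve-∀

wronskian : Poly → Poly → Poly
wronskian g h = g *P yDy h -P yDy g *P h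

wronskian-coefficient : ∀ g h i j k l → wronskian g h i j k l ≡
  Σ⁴ i j k l (λ a b c d → (+ (j ∸ b) - + b) * (g a b c d * h (i ∸ a) (j ∸ b) (k ∸ c) (l ∸ d)))
wronskian-coefficient g h i j k l =
  trans (sym (Σ⁴-sub i j k l _ _))
        (Σ⁴-cong i j k l λ a b c d →
          collect (g a b c d) (h (i ∸ a) (j ∸ b) (k ∸ c) (l ∸ d)) (+ (j ∸ b)) (+ b))
  where
  collect : ∀ u v β α → u * (β * v) - (α * u) * v ≡ (β - α) * (u * v)
  collect = solve-∀

wronskian-cong : ∀ g {h h'} → h ≈ h' → wronskian g h ≈ wronskian g h'
wronskian-cong g h≈h' = -P-cong (*P-congʳ g (yDy-cong h≈h')) (*P-congʳ (yDy g) h≈h')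

wronskian-+P : ∀ g p q → wronskian g (p +P q) ≈ wronskian g p +P wronskian g q
wronskian-+P g p q i j k l =
  trans (cong₂ _-_ (≈-trans (*P-congʳ g (yDy-+P p q)) (*P-distribˡ-+P g (yDy p) (yDy q)) i j k l)
                   (*P-distribˡ-+P (yDy g) p q i j k l))
        (interchange ((g *P yDy p) i j k l) ((g *P yDy q) i j k l)
                     ((yDy g *P p) i j k l) ((yDy g *P q) i j k l))
  where
  interchange : ∀ a b c d → a + b - (c + d) ≡ a - c + (b - d)
  interchange = solve-∀

wronskian-·P : ∀ g n p → wronskian g (n ·P p) ≈ n ·P wronskian g p
wronskian-·P g n p i j k l =
  trans (cong₂ _-_ (≈-trans (*P-congʳ g (yDy-·P n p)) (*P-·Pʳ n g (yDy p)) i j k l)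
                   (*P-·Pʳ n (yDy g) p i j k l))
        (factor (+ n) _ _)
  where
  factor : ∀ c a b → c * a - c * b ≡ c * (a - b)
  factor = solve-∀

wronskian-mulY : ∀ g h → wronskian g (mulY h) ≈ mulY (g *P h) +P mulY (wronskian g h)
wronskian-mulY g h = begin
  g *P yDy (mulY h) -P yDy g *P mulY h
    ≈⟨ -P-cong (*P-congʳ g (yDy-mulY h)) (*P-mulY (yDy g) h) ⟩
  g *P (mulY h +P mulY (yDy h)) -P mulY (yDy g *P h)
    ≈⟨ -P-cong (≈-trans (*P-distribˡ-+P g (mulY h) (mulY (yDy h)))
                        (+P-cong (*P-mulY g h) (*P-mulY g (yDy h))))
               ≈-refl ⟩
  mulY (g *P h) +P mulY (g *P yDy h) -P mulY (yDy g *P h)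
    ≈⟨ reassociate ⟩
  mulY (g *P h) +P mulY (wronskian g h) ∎
  where
  open ≈-Reasoning
  reassociate : ∀ {a b c : Poly} → mulY a +P mulY b -P mulY c ≈ mulY a +P mulY (b -P c)
  reassociate i zero    k l = refl
  reassociate {a} {b} {c} i (suc j) k l = ℤₚ.+-assoc (a i j k l) (b i j k l) (ℤ.- c i j k l)

WronskiNonneg : Poly → Poly → Set
WronskiNonneg g h = ∀ r → InNatPoly (wronskian g (yDyⁿ r h))

WronskiNonneg-≈ : ∀ {g p q} → p ≈ q → WronskiNonneg g q → WronskiNonneg g p
WronskiNonneg-≈ {g} p≈q wn r = ≈-nonneg (wronskian-cong g (yDyⁿ-cong r p≈q)) (wn r)

WronskiNonneg-+P : ∀ {g p q} → WronskiNonneg g p → WronskiNonneg g q → WronskiNonneg g (p +P q)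
WronskiNonneg-+P {g} {p} {q} wp wq r =
  ≈-nonneg (≈-trans (wronskian-cong g (yDyⁿ-+P r p q)) (wronskian-+P g (yDyⁿ r p) (yDyⁿ r q)))
           (+P-nonneg (wp r) (wq r))

WronskiNonneg-·P : ∀ {g} n {p} → WronskiNonneg g p → WronskiNonneg g (n ·P p)
WronskiNonneg-·P {g} n {p} wp r =
  ≈-nonneg (≈-trans (wronskian-cong g (yDyⁿ-·P r n p)) (wronskian-·P g n (yDyⁿ r p)))
           (·P-nonneg n (wp r))

WronskiNonneg-yDy : ∀ {g p} → WronskiNonneg g p → WronskiNonneg g (yDy p)
WronskiNonneg-yDy wp r = wp (suc r)

module CommutingWithyDy
  (mulV : Poly → Poly)
  (mulV-cong : ∀ {p q} → p ≈ q → mulV p ≈ mulV q)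
  (mulV-sub : ∀ p q → mulV p -P mulV q ≈ mulV (p -P q))
  (mulV-nonneg : ∀ {p} → InNatPoly p → InNatPoly (mulV p))
  (*P-mulV : ∀ p q → p *P mulV q ≈ mulV (p *P q))
  (yDy-mulV : ∀ p → yDy (mulV p) ≈ mulV (yDy p))
  where

  yDyⁿ-mulV : ∀ r p → yDyⁿ r (mulV p) ≈ mulV (yDyⁿ r p)
  yDyⁿ-mulV zero    p = ≈-refl
  yDyⁿ-mulV (suc r) p = ≈-trans (yDyⁿ-cong r (yDy-mulV p)) (yDyⁿ-mulV r (yDy p))

  wronskian-mulV : ∀ g h → wronskian g (mulV h) ≈ mulV (wronskian g h)
  wronskian-mulV g h =
    ≈-trans (-P-cong (≈-trans (*P-congʳ g (yDy-mulV h)) (*P-mulV g (yDy h))) (*P-mulV (yDy g) h))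
            (mulV-sub (g *P yDy h) (yDy g *P h))

  WronskiNonneg-mulV : ∀ {g h} → WronskiNonneg g h → WronskiNonneg g (mulV h)
  WronskiNonneg-mulV {g} {h} wn r =
    ≈-nonneg (≈-trans (wronskian-cong g (yDyⁿ-mulV r h)) (wronskian-mulV g (yDyⁿ r h)))
             (mulV-nonneg (wn r))

open CommutingWithyDy mulX mulX-cong mulX-sub mulX-nonneg *P-mulX yDy-mulX
  using () renaming (WronskiNonneg-mulV to WronskiNonneg-mulX)
open CommutingWithyDy mulZ mulZ-cong mulZ-sub mulZ-nonneg *P-mulZ yDy-mulZ
  using () renaming (WronskiNonneg-mulV to WronskiNonneg-mulZ)
open CommutingWithyDy mulT mulT-cong mulT-sub mulT-nonneg *P-mulT yDy-mulT
  using () renaming (WronskiNonneg-mulV to WronskiNonneg-mulT)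

WronskiNonneg-mulY : ∀ {g h} → InNatPoly g → InNatPoly h → WronskiNonneg g h → WronskiNonneg g (mulY h)
WronskiNonneg-mulY {g} {h} g≥0 h≥0 wn zero =
  ≈-nonneg (wronskian-mulY g h) (+P-nonneg (mulY-nonneg (*P-nonneg g≥0 h≥0)) (mulY-nonneg (wn 0)))
WronskiNonneg-mulY {g} {h} g≥0 h≥0 wn (suc r) =
  ≈-nonneg (≈-trans (wronskian-cong g (≈-trans (yDyⁿ-cong r (yDy-mulY h))
                                                (yDyⁿ-+P r (mulY h) (mulY (yDy h)))))
                    (wronskian-+P g (yDyⁿ r (mulY h)) (yDyⁿ r (mulY (yDy h)))))
           (+P-nonneg (WronskiNonneg-mulY g≥0 h≥0 wn r)
                      (WronskiNonneg-mulY g≥0 (yDy-nonneg h≥0) (WronskiNonneg-yDy wn) r))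

WronskiNonneg-refl : ∀ {g} → InNatPoly g → WronskiNonneg g g
WronskiNonneg-refl {g} g≥0 r i j k l =
  subst (+ 0 ℤ.≤_) (sym (wronskian-coefficient g (yDyⁿ r g) i j k l))
        (Σ⁴-nonneg-by-pairing i j k l _ pair≥0)
  where
  pair≥0 : ∀ a b c d → a ≤ i → b ≤ j → c ≤ k → d ≤ l →
    let a' = i ∸ a ; b' = j ∸ b ; c' = k ∸ c ; d' = l ∸ d in
    + 0 ℤ.≤ (+ b' - + b) * (g a b c d * yDyⁿ r g a' b' c' d')
          + (+ (j ∸ b') - + b') * (g a' b' c' d' * yDyⁿ r g (i ∸ a') (j ∸ b') (k ∸ c') (l ∸ d'))
  pair≥0 a b c d a≤i b≤j c≤k d≤l
    rewrite ℕₚ.m∸[m∸n]≡n a≤i | ℕₚ.m∸[m∸n]≡n b≤j | ℕₚ.m∸[m∸n]≡n c≤k | ℕₚ.m∸[m∸n]≡n d≤l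
          | yDyⁿ-coefficient r g (i ∸ a) (j ∸ b) (k ∸ c) (l ∸ d) | yDyⁿ-coefficient r g a b c d =
    subst (+ 0 ℤ.≤_) (sym (symmetrize (g a b c d) (g (i ∸ a) (j ∸ b) (k ∸ c) (l ∸ d))
                                      (+ (j ∸ b)) (+ b) (+ ((j ∸ b) ^ r)) (+ (b ^ r))))
          (*-nonneg (*-nonneg (g≥0 _ _ _ _) (g≥0 _ _ _ _)) ([x-y]*[x^r-y^r]≥0 (j ∸ b) b r))
    where
    symmetrize : ∀ u v β α βʳ αʳ →
      (β - α) * (u * (βʳ * v)) + (α - β) * (v * (αʳ * u)) ≡ (u * v) * ((β - α) * (βʳ - αʳ))
    symmetrize = solve-∀

recurrence : ℕ → Poly → Poly → Poly
recurrence c u v = (mulX u +P c ·P mulZ u) +P ((c ·P mulY u +P mulY v) +P (c ·P mulT u +P mulT v))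

step : ℕ → Poly → Poly
step c h = recurrence c h (yDy h)

recurrence-cong : ∀ c {u u' v v'} → u ≈ u' → v ≈ v' → recurrence c u v ≈ recurrence c u' v'
recurrence-cong c u≈u' v≈v' =
  +P-cong (+P-cong (mulX-cong u≈u') (·P-cong c (mulZ-cong u≈u')))
          (+P-cong (+P-cong (·P-cong c (mulY-cong u≈u')) (mulY-cong v≈v'))
                   (+P-cong (·P-cong c (mulT-cong u≈u')) (mulT-cong v≈v')))

*P-recurrence : ∀ g c u v → g *P recurrence c u v ≈ recurrence c (g *P u) (g *P v)
*P-recurrence g c u v =
  sum (mulX u +P c ·P mulZ u) ((c ·P mulY u +P mulY v) +P (c ·P mulT u +P mulT v))
    (sum (mulX u) (c ·P mulZ u) (*P-mulX g u) (scaled (mulZ u) (*P-mulZ g u)))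
    (sum (c ·P mulY u +P mulY v) (c ·P mulT u +P mulT v)
      (sum (c ·P mulY u) (mulY v) (scaled (mulY u) (*P-mulY g u)) (*P-mulY g v))
      (sum (c ·P mulT u) (mulT v) (scaled (mulT u) (*P-mulT g u)) (*P-mulT g v)))
  where
  sum : ∀ p q {p' q'} → g *P p ≈ p' → g *P q ≈ q' → g *P (p +P q) ≈ p' +P q'
  sum p q gp≈p' gq≈q' = ≈-trans (*P-distribˡ-+P g p q) (+P-cong gp≈p' gq≈q')
  scaled : ∀ p {p'} → g *P p ≈ p' → g *P (c ·P p) ≈ c ·P p'
  scaled p gp≈p' = ≈-trans (*P-·Pʳ c g p) (·P-cong c gp≈p')

recurrence-nonneg : ∀ c {u v} → InNatPoly u → InNatPoly v → InNatPoly (recurrence c u v)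
recurrence-nonneg c u≥0 v≥0 =
  +P-nonneg (+P-nonneg (mulX-nonneg u≥0) (·P-nonneg c (mulZ-nonneg u≥0)))
            (+P-nonneg (+P-nonneg (·P-nonneg c (mulY-nonneg u≥0)) (mulY-nonneg v≥0))
                       (+P-nonneg (·P-nonneg c (mulT-nonneg u≥0)) (mulT-nonneg v≥0)))

recurrence-difference : ∀ c' e u v w →
  recurrence (c' ℕ.+ e) u v -P recurrence c' u w
  ≈ e ·P (mulZ u +P mulY u +P mulT u) +P mulY (v -P w) +P mulT (v -P w)
recurrence-difference c' e u v w i j k l
  rewrite ℤₚ.pos-+ c' e | sym (mulY-sub v w i j k l) | sym (mulT-sub v w i j k l) =
  expand (mulX u i j k l) (mulZ u i j k l) (mulY u i j k l) (mulT u i j k l)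
         (mulY v i j k l) (mulY w i j k l) (mulT v i j k l) (mulT w i j k l) (+ c') (+ e)
  where
  expand : ∀ A B C D Yv Yw Tv Tw c' e →
    (A + (c' + e) * B) + (((c' + e) * C + Yv) + ((c' + e) * D + Tv))
      - ((A + c' * B) + ((c' * C + Yw) + (c' * D + Tw)))
    ≡ e * (B + C + D) + (Yv - Yw) + (Tv - Tw)
  expand = solve-∀

recurrence-difference-nonneg : ∀ {c c' u v w} → c' ≤ c → InNatPoly u → InNatPoly (v -P w) →
  InNatPoly (recurrence c u v -P recurrence c' u w)
recurrence-difference-nonneg {c' = c'} {u} {v} {w} c'≤c u≥0 v-w≥0 with ℕₚ.m≤n⇒∃[o]m+o≡n c'≤c
... | e , refl =
  ≈-nonneg (recurrence-difference c' e u v w)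
    (+P-nonneg (+P-nonneg (·P-nonneg e (+P-nonneg (+P-nonneg (mulZ-nonneg u≥0) (mulY-nonneg u≥0))
                                                  (mulT-nonneg u≥0)))
                          (mulY-nonneg v-w≥0))
               (mulT-nonneg v-w≥0))

step-product-difference : ∀ g h c c' →
  g *P step c h -P step c' g *P h
  ≈ recurrence c (g *P h) (g *P yDy h) -P recurrence c' (g *P h) (yDy g *P h)
step-product-difference g h c c' = -P-cong (*P-recurrence g c h (yDy h)) (begin
  step c' g *P h                        ≈⟨ *P-comm (step c' g) h ⟩
  h *P step c' g                        ≈⟨ *P-recurrence h c' g (yDy g) ⟩
  recurrence c' (h *P g) (h *P yDy g)   ≈⟨ recurrence-cong c' (*P-comm h g) (*P-comm h (yDy g)) ⟩
  recurrence c' (g *P h) (yDy g *P h)   ∎)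
  where open ≈-Reasoning

WronskiNonneg-step : ∀ {g h} c → InNatPoly g → InNatPoly h → WronskiNonneg g h →
  WronskiNonneg g (step c h)
WronskiNonneg-step c g≥0 h≥0 wn =
  WronskiNonneg-+P
    (WronskiNonneg-+P (WronskiNonneg-mulX wn) (WronskiNonneg-·P c (WronskiNonneg-mulZ wn)))
    (WronskiNonneg-+P
      (WronskiNonneg-+P (WronskiNonneg-·P c (WronskiNonneg-mulY g≥0 h≥0 wn))
                        (WronskiNonneg-mulY g≥0 (yDy-nonneg h≥0) (WronskiNonneg-yDy wn)))
      (WronskiNonneg-+P (WronskiNonneg-·P c (WronskiNonneg-mulT wn))
                        (WronskiNonneg-mulT (WronskiNonneg-yDy wn))))

Q-step : ∀ n → Q (suc (suc n)) ≈ step (suc n) (Q (suc n))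
Q-step n = +P-cong xz-part yt-part
  where
  c = suc n
  h = Q (suc n)
  xz-part : (X +P c ·P Z) *P h ≈ mulX h +P c ·P mulZ h
  xz-part = ≈-trans (*P-distribʳ-+P h X (c ·P Z))
                    (+P-cong (X*P≈mulX h) (≈-trans (*P-·Pˡ c Z h) (·P-cong c (Z*P≈mulZ h))))
  linear : ∀ (V : Poly) (mulV : Poly → Poly) → (∀ p → V *P p ≈ mulV p) →
    V *P (c ·P h +P yDy h) ≈ c ·P mulV h +P mulV (yDy h)
  linear V mulV V*P≈mulV = ≈-trans (*P-distribˡ-+P V (c ·P h) (yDy h))
    (+P-cong (≈-trans (*P-·Pʳ c V h) (·P-cong c (V*P≈mulV h))) (V*P≈mulV (yDy h)))
  yt-part : (Y +P T) *P (c ·P h +P yDy h)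
            ≈ (c ·P mulY h +P mulY (yDy h)) +P (c ·P mulT h +P mulT (yDy h))
  yt-part = ≈-trans (*P-distribʳ-+P (c ·P h +P yDy h) Y T)
                    (+P-cong (linear Y mulY Y*P≈mulY) (linear T mulT T*P≈mulT))

Q-nonneg : ∀ n → InNatPoly (Q n)
Q-nonneg zero          i j k l = +≤+ z≤n
Q-nonneg (suc zero)    = 1P-nonneg
Q-nonneg (suc (suc n)) =
  ≈-nonneg (Q-step n) (recurrence-nonneg (suc n) (Q-nonneg (suc n)) (yDy-nonneg (Q-nonneg (suc n))))

WronskiNonneg-Q : ∀ {j n} → j ≤′ n → WronskiNonneg (Q (suc j)) (Q (suc n))
WronskiNonneg-Q {j} ≤′-refl = WronskiNonneg-refl (Q-nonneg (suc j))
WronskiNonneg-Q {j} (≤′-step {n} j≤′n) =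
  WronskiNonneg-≈ (Q-step n)
    (WronskiNonneg-step (suc n) (Q-nonneg (suc j)) (Q-nonneg (suc n)) (WronskiNonneg-Q j≤′n))

theorem1p5 : ∀ (n m : ℕ) → 2 ≤ m → m ≤ n →
    InNatPoly (Q (m ∸ 1) *P Q (suc n) -P Q m *P Q n)
theorem1p5 zero    (suc (suc j)) _ ()
theorem1p5 (suc n) (suc (suc j)) (s≤s (s≤s _)) (s≤s 1+j≤n) =
  ≈-nonneg (-P-cong (*P-congʳ g (Q-step n)) (*P-congˡ h (Q-step j)))
    (≈-nonneg (step-product-difference g h (suc n) (suc j))
      (recurrence-difference-nonneg (s≤s j≤n) (*P-nonneg (Q-nonneg (suc j)) (Q-nonneg (suc n)))
                                    (WronskiNonneg-Q (ℕₚ.≤⇒≤′ j≤n) 0)))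
  where
  g = Q (suc j)
  h = Q (suc n)
  j≤n = ℕₚ.<⇒≤ 1+j≤n
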